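{- Let $l\ge2$, let $m\in\{1,2,3\}$ with $m\le 2l-2$, and let $C$ be an odd cycle with vertices in cyclic order $v_1,\ldots,v_{2l+1}$. Define $G_{l,m,1}$ as $C$ together with new vertices $u_1,s_1$, where $u_1$ is adjacent to every vertex of $\{v_j:1\le j\le 2+m\}$ and $s_1$ is adjacent to every vertex of $V(C)\setminus\{v_1,v_2\}$. For $k\ge2$, obtain $G_{l,m,k}$ from $G_{l,m,k-1}$ by adding new vertices $u_k$ and $s_k$, with $u_k$ adjacent to $\{u_j:1\le j\le k-1\}\cup\{v_j:1\le j\le 2+m\}$ and $s_k$ adjacent to $\{s_j:1\le j\le k-1\}\cup(V(C)\setminus\{v_1,v_2\})$. Then for every positive integer $k$, $G_{l,m,k}$ is strong $(3+k)$-chromatic-choosable. Moreover, when $m\in\{2,3\}$, $G_{l,m,k}$ is not strong $(3+k)$-critical.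
   Context: A list assignment gives each vertex a color set; a $k$-assignment has all lists of size $k$; $G$ is $L$-colorable if it has a proper coloring choosing each vertex's color from its list. A list assignment is constant if all lists are equal. $G$ is strong $k$-chromatic-choosable if $\chi(G)=k$ and every $(k-1)$-assignment $L$ for which $G$ is not $L$-colorable is constant. A graph is $k$-critical if its chromatic number is $k$ and every proper subgraph has chromatic number less than $k$. A graph is strong $k$-critical if it is $k$-critical and every $(k-1)$-assignment for which it is not $L$-colorable is constant. -}

module Defs where

open import Data.Nat using (ℕ; zero; suc; _+_; _∸_; _≤_; _<_)
open import Data.Fin using (Fin; toℕ)
open import Data.Sum using (_⊎_; inj₁; inj₂)
open import Data.Product using (Σ; ∃; _×_; _,_)
open import Data.Empty using (⊥)
open import Data.List using (List; length)
open import Data.List.Membership.Propositional using (_∈_)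
open import Data.List.Relation.Unary.Unique.Propositional using (Unique)
open import Relation.Nullary using (¬_)
open import Relation.Binary.PropositionalEquality using (_≡_)
open import Function.Bundles using (_⇔_)

record Graph : Set₁ where
  field
    V   : Set
    Adj : V → V → Set
open Graph public

Proper : (G : Graph) {C : Set} → (V G → C) → Set
Proper G c = ∀ u v → Adj G u v → ¬ (c u ≡ c v)

Colorable : Graph → ℕ → Set
Colorable G k = Σ (V G → Fin k) λ c → Proper G c

HasChromaticNumber : Graph → ℕ → Set
HasChromaticNumber G k = Colorable G k × (∀ j → j < k → ¬ Colorable G j)

ChromaticLess : Graph → ℕ → Set
ChromaticLess G k = Σ ℕ λ j → j < k × Colorable G j

ListAssignment : Graph → Set
ListAssignment G = V G → List ℕ

IsAssignmentOfSize : (G : Graph) → ℕ → ListAssignment G → Set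
IsAssignmentOfSize G k L = ∀ v → Unique (L v) × length (L v) ≡ k

LColorable : (G : Graph) → ListAssignment G → Set
LColorable G L = Σ (V G → ℕ) λ c → (∀ v → c v ∈ L v) × Proper G c

Constant : (G : Graph) → ListAssignment G → Set
Constant G L = ∀ u v → ∀ x → (x ∈ L u) ⇔ (x ∈ L v)

NonColorableAssignmentsConstant : Graph → ℕ → Set
NonColorableAssignmentsConstant G k =
  ∀ (L : ListAssignment G) → IsAssignmentOfSize G (k ∸ 1) L →
    ¬ LColorable G L → Constant G L

StrongChromaticChoosable : Graph → ℕ → Set
StrongChromaticChoosable G k =
  HasChromaticNumber G k × NonColorableAssignmentsConstant G k

record Subgraph (G : Graph) : Set₁ where
  field
    P     : V G → Set
    F     : V G → V G → Set
    F⊆Adj : ∀ u v → F u v → Adj G u v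
    F-sym : ∀ u v → F u v → F v u
    F⊆P   : ∀ u v → F u v → P u × P v
open Subgraph public

toGraph : {G : Graph} → Subgraph G → Graph
toGraph {G} H = record { V = Σ (V G) (P H) ; Adj = λ { (u , _) (v , _) → F H u v } }

ProperSubgraph : {G : Graph} → Subgraph G → Set
ProperSubgraph {G} H =
  (∃ λ v → ¬ P H v) ⊎ (∃ λ u → ∃ λ v → Adj G u v × ¬ F H u v)

Critical : Graph → ℕ → Set₁
Critical G k = HasChromaticNumber G k ×
  (∀ (H : Subgraph G) → ProperSubgraph H → ChromaticLess (toGraph H) k)

StrongCritical : Graph → ℕ → Set₁
StrongCritical G k = Critical G k × NonColorableAssignmentsConstant G k

-- The graphs G_{l,m,k}
-- vertices: inj₁ i        = v_{i+1}   (i : Fin (2l+1))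
--           inj₂ (inj₁ a) = u_{a+1}   (a : Fin k)
--           inj₂ (inj₂ a) = s_{a+1}   (a : Fin k)

GVertex : ℕ → ℕ → Set
GVertex l k = Fin (suc (l + l)) ⊎ (Fin k ⊎ Fin k)

-- one orientation of each edge
GRel : (l m k : ℕ) → GVertex l k → GVertex l k → Set
-- cycle edges v_{i+1} v_{i+2}, and v_{2l+1} v_1
GRel l m k (inj₁ i) (inj₁ j) = (toℕ j ≡ suc (toℕ i)) ⊎ (toℕ i ≡ l + l × toℕ j ≡ 0)
-- u_a adjacent to v_j for 1 ≤ j ≤ 2+m
GRel l m k (inj₂ (inj₁ a)) (inj₁ i) = toℕ i < 2 + m
-- s_a adjacent to v_j for j ≥ 3
GRel l m k (inj₂ (inj₂ a)) (inj₁ i) = 2 ≤ toℕ i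
GRel l m k (inj₂ (inj₁ a)) (inj₂ (inj₁ b)) = toℕ b < toℕ a
GRel l m k (inj₂ (inj₂ a)) (inj₂ (inj₂ b)) = toℕ b < toℕ a
GRel l m k _ _ = ⊥

G : (l m k : ℕ) → Graph
G l m k = record
  { V   = GVertex l k
  ; Adj = λ x y → GRel l m k x y ⊎ GRel l m k y x
  }

module Submission where

-- On the odd cycle a color x ∈ L(vᵢ) missing
-- from L(vᵢ₊₁) can be propagated greedily around the cycle starting at vᵢ, so a non-colorable
-- 2-assignment has all lists equal. For the step, pick a ∈ L(u₀) and b ∈ L(s₀) that never meet in
-- a common neighbour of u₀ and s₀, and delete a from the lists of the other neighbours of u₀ and b
-- from those of s₀: the result is a non-colorable assignment of G l m k with lists of size at
-- least k + 2, hence by induction (after trimming) constant with lists of size exactly k + 2. So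
-- every vertex loses a or b, and the remaining colors are the same everywhere. Comparing such
-- reductions for several pairs shows that L is constant when L(u₀) and L(s₀) meet, and is
-- contradictory when they are disjoint; if no admissible pair exists at all, double counting over
-- the at most three common neighbours v₂, v₃, v₄ gives a contradiction.
--
-- For the chromatic number, in a (k+2)-coloring the u-clique forces v₀ and v₂ to share a color
-- and the s-clique does the same for v₂ₜ and v₂ₜ₊₂, so the edge v₂ₗv₀ is monochromatic. This only
-- uses the edges of G l 1 k, which for m ≥ 2 is a proper subgraph of G l m k.

open import Defs
open import Data.Nat using (ℕ; zero; suc; _+_; _*_; _∸_; _⊓_; _≤_; _<_; z≤n; s≤s; s≤s⁻¹;
  _≤?_; _<?_; _≟_)
open import Data.Nat.Properties using (≤-trans; ≤-refl; ≤-antisym; ≤-reflexive; n≤1+n; 1+n≰n; ≮⇒≥;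
  <⇒≤; <-irrefl; <-cmp; m≤n⇒m⊓n≡m; m≤n⇒m<n∨m≡n; +-suc; +-comm; +-assoc; +-identityʳ;
  +-mono-≤; +-monoʳ-≤; m+n≤o⇒m≤o∸n; m+1+n≰m; m≤n+m; m≤m+n; m+[n∸m]≡n; module ≤-Reasoning)
open import Data.Nat.DivMod using (_%_; _mod_; %-distribˡ-+; m%n%n≡m%n; [m+n]%n≡m%n;
  m<n⇒m%n≡m; n%n≡0)
open import Data.Nat.Tactic.RingSolver using (solve-∀)
open import Data.Fin using (Fin; zero; suc; toℕ; fromℕ; fromℕ<; inject≤; _↑ˡ_; _↑ʳ_)
import Data.Fin
open import Data.Fin.Properties using (toℕ-injective; toℕ-fromℕ<; toℕ-fromℕ; toℕ<n; fromℕ<-toℕ;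
  inject≤-injective; injective⇒≤; ↑ˡ-injective; ↑ʳ-injective)
import Data.Fin.Properties
import Data.Vec.Functional as Vector
open import Data.List using (List; []; _∷_; length; _++_; filter; take; drop)
open import Data.List.Properties using (length-++; length-++-sucʳ; length-take; length-drop;
  take-all; filter-accept; filter-reject; filter-all)
open import Data.List.Membership.Propositional using (_∈_; _∉_; find; lose)
open import Data.List.Membership.Propositional.Properties using (∈-++⁻; ∈-++⁺ˡ; ∈-++⁺ʳ; ∈-∃++;
  ∈-filter⁻; ∈-filter⁺)
open import Data.List.Membership.DecPropositional _≟_ using (_∈?_)
open import Data.List.Relation.Binary.Subset.Propositional using (_⊆_)
open import Data.List.Relation.Binary.Disjoint.Propositional using (Disjoint)
import Data.List.Relation.Binary.Sublist.Propositional as Sublist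
import Data.List.Relation.Binary.Sublist.Propositional.Properties as Sublist
open import Data.List.Relation.Unary.All using (All; []; _∷_; all?)
import Data.List.Relation.Unary.All as All
open import Data.List.Relation.Unary.All.Properties using (¬Any⇒All¬; ¬All⇒Any¬)
open import Data.List.Relation.Unary.Any using (here; there; any?)
open import Data.List.Relation.Unary.Unique.Propositional using (Unique; []; _∷_)
open import Data.List.Relation.Unary.Unique.Propositional.Properties using (take⁺; drop⁺; filter⁺; ++⁺)
open import Data.Product using (∃; _×_; _,_; proj₁; proj₂; swap; uncurry)
open import Data.Sum using (_⊎_; inj₁; inj₂; [_,_])
import Data.Sum
open import Data.Sum.Properties using (≡-dec)
open import Data.Empty using (⊥; ⊥-elim)
open import Data.Unit using (⊤; tt)
open import Function using (_∘_; id)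
open import Function.Bundles using (_⇔_; mk⇔; Equivalence)
open import Function.Definitions using (Injective)
open import Relation.Nullary using (¬_; Dec; yes; no; contradiction; ¬?; _×-dec_; _⊎-dec_)
open import Relation.Nullary.Decidable using (decidable-stable)
open import Relation.Binary using (DecidableEquality; tri<; tri≈; tri>)
open import Relation.Binary.PropositionalEquality
  using (_≡_; _≢_; refl; sym; trans; cong; cong₂; subst; subst₂; ≢-sym; module ≡-Reasoning)

module _ {A : Set} where

  ∈-take⁻ : ∀ {x : A} n xs → x ∈ take n xs → x ∈ xs
  ∈-take⁻ n xs = Sublist.lookup (Sublist.take-⊆ n xs)

  ∈-drop⁻ : ∀ {x : A} n xs → x ∈ drop n xs → x ∈ xs
  ∈-drop⁻ n xs = Sublist.lookup (Sublist.drop-⊆ n xs)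

  ∈-++-removeMiddle : ∀ {x y : A} xs ys → y ∈ xs ++ x ∷ ys → y ≢ x → y ∈ xs ++ ys
  ∈-++-removeMiddle xs ys y∈ y≢x with ∈-++⁻ xs y∈
  ... | inj₁ y∈xs         = ∈-++⁺ˡ y∈xs
  ... | inj₂ (here y≡x)   = contradiction y≡x y≢x
  ... | inj₂ (there y∈ys) = ∈-++⁺ʳ xs y∈ys

  Unique-⊆⇒length-≤ : {xs ys : List A} → Unique xs → xs ⊆ ys → length xs ≤ length ys
  Unique-⊆⇒length-≤ [] _ = z≤n
  Unique-⊆⇒length-≤ {x ∷ xs} (x≢xs ∷ !xs) x∷xs⊆ys
    with ys₁ , ys₂ , refl ← ∈-∃++ (x∷xs⊆ys (here refl)) = begin
      suc (length xs)           ≤⟨ s≤s (Unique-⊆⇒length-≤ !xs xs⊆ys₁++ys₂) ⟩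
      suc (length (ys₁ ++ ys₂)) ≡⟨ length-++-sucʳ ys₁ x ys₂ ⟨
      length (ys₁ ++ x ∷ ys₂)   ∎
    where
    open ≤-Reasoning
    xs⊆ys₁++ys₂ : xs ⊆ ys₁ ++ ys₂
    xs⊆ys₁++ys₂ y∈xs =
      ∈-++-removeMiddle ys₁ ys₂ (x∷xs⊆ys (there y∈xs)) (≢-sym (All.lookup x≢xs y∈xs))

  Unique-∷ : ∀ {x : A} {xs} → x ∉ xs → Unique xs → Unique (x ∷ xs)
  Unique-∷ {xs = xs} x∉xs !xs = ¬Any⇒All¬ xs x∉xs ∷ !xs

  Unique-∉-⊆⇒length-< : ∀ {x : A} {xs ys} → Unique xs → x ∉ xs → x ∈ ys → xs ⊆ ys → length xs < length ys
  Unique-∉-⊆⇒length-< !xs x∉xs x∈ys xs⊆ys =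
    Unique-⊆⇒length-≤ (Unique-∷ x∉xs !xs) λ { (here refl) → x∈ys ; (there y∈xs) → xs⊆ys y∈xs }

  module _ {p} {P : A → Set p} (P? : ∀ x → Dec (P x)) where

    length-filter-rejectingOne : ∀ {xs} → Unique xs →
      (∀ {x y} → x ∈ xs → y ∈ xs → ¬ P x → ¬ P y → x ≡ y) →
      length xs ≤ suc (length (filter P? xs))
    length-filter-rejectingOne {[]} _ _ = z≤n
    length-filter-rejectingOne {x ∷ xs} (x≢xs ∷ !xs) rejectsOne = byDecision (P? x)
      where
      byDecision : Dec (P x) → suc (length xs) ≤ suc (length (filter P? (x ∷ xs)))
      byDecision (yes Px) rewrite filter-accept P? {xs = xs} Px =
        s≤s (length-filter-rejectingOne !xs λ x∈ y∈ → rejectsOne (there x∈) (there y∈))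
      byDecision (no ¬Px) rewrite filter-reject P? {xs = xs} ¬Px =
        ≤-reflexive (cong (suc ∘ length) (sym (filter-all P? (All.tabulate accepted))))
        where
        accepted : ∀ {y} → y ∈ xs → P y
        accepted {y} y∈xs with P? y
        ... | yes Py  = Py
        ... | no  ¬Py =
          contradiction (rejectsOne (here refl) (there y∈xs) ¬Px ¬Py) (All.lookup x≢xs y∈xs)

module _ {A : Set} (_≟_ : DecidableEquality A) where

  Unique-⊆-length⇒⊇ : {xs ys : List A} → Unique xs → xs ⊆ ys → length ys ≤ length xs → ys ⊆ xs
  Unique-⊆-length⇒⊇ {xs} {ys} !xs xs⊆ys |ys|≤|xs| {y} y∈ys with any? (y ≟_) xs
  ... | yes y∈xs = y∈xs
  ... | no  y∉xs = contradiction (≤-trans (Unique-∉-⊆⇒length-< !xs y∉xs y∈ys xs⊆ys) |ys|≤|xs|) 1+n≰n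

  length-filter-≢ : ∀ {xs} (a : A) → Unique xs → length xs ≤ suc (length (filter (¬? ∘ (_≟ a)) xs))
  length-filter-≢ a !xs = length-filter-rejectingOne (¬? ∘ (_≟ a)) !xs
    λ _ _ ¬x≢a ¬y≢a → trans (decidable-stable (_ ≟ a) ¬x≢a) (sym (decidable-stable (_ ≟ a) ¬y≢a))

  another : ∀ {xs} → Unique xs → 2 ≤ length xs → (x : A) → ∃ λ y → y ∈ xs × y ≢ x
  another {y ∷ z ∷ _} ((y≢z ∷ _) ∷ _) _ x with y ≟ x
  ... | yes refl = z , there (here refl) , ≢-sym y≢z
  ... | no  y≢x  = y , here refl , y≢x
  another {_ ∷ []} _ (s≤s ()) _

fromOriented : {W C : Set} {R : W → W → Set} {c : W → C} →
  (∀ x y → R x y → c x ≢ c y) → ∀ x y → R x y ⊎ R y x → c x ≢ c y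
fromOriented proper x y (inj₁ r) = proper x y r
fromOriented proper x y (inj₂ r) = proper y x r ∘ sym

LColorable-reindex : (G : Graph) (L : ListAssignment G) {ρ σ : V G → V G} →
  (∀ v → ρ (σ v) ≡ v) → (∀ u v → Adj G u v → Adj G (σ u) (σ v)) →
  LColorable G (L ∘ ρ) → LColorable G L
LColorable-reindex G L {ρ} {σ} ρ∘σ≗id σ-adj (c , c∈ , proper) =
  c ∘ σ ,
  (λ v → subst (λ w → c (σ v) ∈ L w) (ρ∘σ≗id v) (c∈ (σ v))) ,
  (λ u v adj → proper (σ u) (σ v) (σ-adj u v adj))

constant-viaRoot : (G : Graph) (L : ListAssignment G) (r : V G) →
  (∀ v → L v ⊆ L r) → (∀ v → L r ⊆ L v) → Constant G L
constant-viaRoot G L r toRoot fromRoot u v x = mk⇔ (fromRoot v ∘ toRoot u) (fromRoot u ∘ toRoot v)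

CycleEdge : (n : ℕ) → Fin (suc n) → Fin (suc n) → Set
CycleEdge n i j = (toℕ j ≡ suc (toℕ i)) ⊎ (toℕ i ≡ n × toℕ j ≡ 0)

Cycle : ℕ → Graph
Cycle n = record { V = Fin (suc n) ; Adj = λ i j → CycleEdge n i j ⊎ CycleEdge n j i }

module _ {n : ℕ} where

  open ≡-Reasoning

  toℕ-mod : (i : Fin (suc n)) → toℕ i mod suc n ≡ i
  toℕ-mod i = toℕ-injective (trans (toℕ-fromℕ< _) (m<n⇒m%n≡m (toℕ<n i)))

  %-absorbʳ : ∀ a b → (a + b % suc n) % suc n ≡ (a + b) % suc n
  %-absorbʳ a b = begin
    (a + b % suc n) % suc n                 ≡⟨ %-distribˡ-+ a (b % suc n) (suc n) ⟩
    (a % suc n + b % suc n % suc n) % suc n ≡⟨ cong (λ t → (a % suc n + t) % suc n)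
                                                    (m%n%n≡m%n b (suc n)) ⟩
    (a % suc n + b % suc n) % suc n         ≡⟨ %-distribˡ-+ a b (suc n) ⟨
    (a + b) % suc n                         ∎

  CycleEdge⇒≡suc% : {i j : Fin (suc n)} → CycleEdge n i j → toℕ j ≡ suc (toℕ i) % suc n
  CycleEdge⇒≡suc% {i} {j} (inj₁ j≡1+i) = trans j≡1+i (sym (m<n⇒m%n≡m (subst (_< suc n) j≡1+i (toℕ<n j))))
  CycleEdge⇒≡suc% (inj₂ (i≡n , j≡0)) rewrite i≡n | j≡0 = sym (n%n≡0 (suc n))

  ≡suc%⇒CycleEdge : {i j : Fin (suc n)} → toℕ j ≡ suc (toℕ i) % suc n → CycleEdge n i j
  ≡suc%⇒CycleEdge {i} {j} j≡ with m≤n⇒m<n∨m≡n (s≤s⁻¹ (toℕ<n i))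
  ... | inj₁ i<n = inj₁ (trans j≡ (m<n⇒m%n≡m (s≤s i<n)))
  ... | inj₂ i≡n = inj₂ (i≡n , trans j≡ (trans (cong (λ t → suc t % suc n) i≡n) (n%n≡0 (suc n))))

  rotate : ℕ → Fin (suc n) → Fin (suc n)
  rotate r i = (r + toℕ i) mod suc n

  toℕ-rotate : ∀ r i → toℕ (rotate r i) ≡ (r + toℕ i) % suc n
  toℕ-rotate r i = toℕ-fromℕ< _

  rotate-edge : ∀ r {i j} → CycleEdge n i j → CycleEdge n (rotate r i) (rotate r j)
  rotate-edge r {i} {j} e = ≡suc%⇒CycleEdge (begin
    toℕ (rotate r j)               ≡⟨ toℕ-rotate r j ⟩
    (r + toℕ j) % suc n            ≡⟨ cong (λ t → (r + t) % suc n) (CycleEdge⇒≡suc% e) ⟩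
    (r + suc (toℕ i) % suc n) % suc n ≡⟨ %-absorbʳ r (suc (toℕ i)) ⟩
    (r + suc (toℕ i)) % suc n      ≡⟨ cong (_% suc n) (+-suc r (toℕ i)) ⟩
    suc (r + toℕ i) % suc n        ≡⟨ %-absorbʳ 1 (r + toℕ i) ⟨
    suc ((r + toℕ i) % suc n) % suc n ≡⟨ cong (λ t → suc t % suc n) (toℕ-rotate r i) ⟨
    suc (toℕ (rotate r i)) % suc n ∎)

  rotate-inverse : ∀ q i → q ≤ suc n → rotate q (rotate (suc n ∸ q) i) ≡ i
  rotate-inverse q i q≤N = toℕ-injective (begin
    toℕ (rotate q (rotate (suc n ∸ q) i))      ≡⟨ toℕ-rotate q _ ⟩
    (q + toℕ (rotate (suc n ∸ q) i)) % suc n  ≡⟨ cong (λ t → (q + t) % suc n)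
                                                      (toℕ-rotate (suc n ∸ q) i) ⟩
    (q + (suc n ∸ q + toℕ i) % suc n) % suc n ≡⟨ %-absorbʳ q (suc n ∸ q + toℕ i) ⟩
    (q + (suc n ∸ q + toℕ i)) % suc n         ≡⟨ cong (_% suc n) (+-assoc q (suc n ∸ q) (toℕ i)) ⟨
    (q + (suc n ∸ q) + toℕ i) % suc n         ≡⟨ cong (λ t → (t + toℕ i) % suc n) (m+[n∸m]≡n q≤N) ⟩
    (suc n + toℕ i) % suc n                   ≡⟨ cong (_% suc n) (+-comm (suc n) (toℕ i)) ⟩
    (toℕ i + suc n) % suc n                   ≡⟨ [m+n]%n≡m%n (toℕ i) (suc n) ⟩
    toℕ i % suc n                             ≡⟨ m<n⇒m%n≡m (toℕ<n i) ⟩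
    toℕ i                                     ∎)

  -- Color the path 0, 1, …, n greedily from x; the closing edge n–0 is safe because x ∉ L n.
  greedy-coloring : (L : Fin (suc n) → List ℕ) → (∀ i → Unique (L i) × length (L i) ≡ 2) →
    ∀ {x} → x ∈ L zero → x ∉ L (fromℕ n) → LColorable (Cycle n) L
  greedy-coloring L two {x} x∈L₀ x∉Lₙ = color , color∈ , fromOriented proper
    where
    choose : ∀ i y → ∃ λ z → z ∈ L i × z ≢ y
    choose i = another _≟_ (proj₁ (two i)) (≤-reflexive (sym (proj₂ (two i))))

    walk : ℕ → ℕ
    walk zero    = x
    walk (suc t) = proj₁ (choose (suc t mod suc n) (walk t))

    walk∈ : ∀ t → walk t ∈ L (t mod suc n)
    walk∈ zero    = x∈L₀
    walk∈ (suc t) = proj₁ (proj₂ (choose (suc t mod suc n) (walk t)))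

    color : Fin (suc n) → ℕ
    color i = walk (toℕ i)

    color∈ : ∀ i → color i ∈ L i
    color∈ i = subst (λ j → color i ∈ L j) (toℕ-mod i) (walk∈ (toℕ i))

    proper : ∀ i j → CycleEdge n i j → color i ≢ color j
    proper i j (inj₁ j≡1+i) eq =
      proj₂ (proj₂ (choose _ (walk (toℕ i)))) (trans (cong walk (sym j≡1+i)) (sym eq))
    proper i j (inj₂ (i≡n , j≡0)) eq =
      x∉Lₙ (subst₂ _∈_ (trans eq (cong walk j≡0)) (cong L i≡last) (color∈ i))
      where
      i≡last : i ≡ fromℕ n
      i≡last = toℕ-injective (trans i≡n (sym (toℕ-fromℕ n)))

  module _ (L : Fin (suc n) → List ℕ) (two : ∀ i → Unique (L i) × length (L i) ≡ 2)
           (nc : ¬ LColorable (Cycle n) L) where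

    -- Rotating by q = 1 + i moves j = i + 1 to 0 and i to n, so greedy coloring applies.
    successor-⊆ : ∀ i j → toℕ j ≡ suc (toℕ i) → L j ⊆ L i
    successor-⊆ i j j≡1+i {x} x∈Lj with x ∈? L i
    ... | yes x∈Li = x∈Li
    ... | no  x∉Li = ⊥-elim (nc (LColorable-reindex (Cycle n) L
                      (λ v → rotate-inverse (toℕ j) v (<⇒≤ (toℕ<n j)))
                      (λ u v → Data.Sum.map (rotate-edge (suc n ∸ toℕ j)) (rotate-edge (suc n ∸ toℕ j)))
                      (greedy-coloring (L ∘ rotate (toℕ j)) (two ∘ rotate (toℕ j))
                        (subst (λ v → x ∈ L v) (sym rotate-zero) x∈Lj)
                        (subst (λ v → x ∉ L v) (sym rotate-last) x∉Li))))
      where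
      rotate-zero : rotate (toℕ j) zero ≡ j
      rotate-zero = toℕ-injective (trans (toℕ-rotate (toℕ j) zero)
                      (trans (cong (_% suc n) (+-identityʳ (toℕ j))) (m<n⇒m%n≡m (toℕ<n j))))
      rotate-last : rotate (toℕ j) (fromℕ n) ≡ i
      rotate-last = toℕ-injective (begin
        toℕ (rotate (toℕ j) (fromℕ n)) ≡⟨ toℕ-rotate (toℕ j) (fromℕ n) ⟩
        (toℕ j + toℕ (fromℕ n)) % suc n ≡⟨ cong₂ (λ a b → (a + b) % suc n) j≡1+i (toℕ-fromℕ n) ⟩
        (suc (toℕ i) + n) % suc n      ≡⟨ cong (_% suc n) (+-suc (toℕ i) n) ⟨
        (toℕ i + suc n) % suc n        ≡⟨ [m+n]%n≡m%n (toℕ i) (suc n) ⟩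
        toℕ i % suc n                  ≡⟨ m<n⇒m%n≡m (toℕ<n i) ⟩
        toℕ i                          ∎)

    ⊆-zero : ∀ i → L i ⊆ L zero
    ⊆-zero i = subst (λ v → L v ⊆ L zero) (fromℕ<-toℕ i (toℕ<n i)) (below (toℕ i) (toℕ<n i))
      where
      below : ∀ t .(t<N : t < suc n) → L (fromℕ< t<N) ⊆ L zero
      below zero    _   = id
      below (suc t) t<N = below t (≤-trans (n≤1+n _) t<N)
                        ∘ successor-⊆ _ _ (trans (toℕ-fromℕ< t<N) (cong suc (sym (toℕ-fromℕ< _))))

Cycle-nonColorableAssignmentsConstant : ∀ n → NonColorableAssignmentsConstant (Cycle n) 3
Cycle-nonColorableAssignmentsConstant n L two nc =
  constant-viaRoot (Cycle n) L zero (⊆-zero L two nc) λ i →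
    Unique-⊆-length⇒⊇ _≟_ (proj₁ (two i)) (⊆-zero L two nc i)
    (≤-reflexive (trans (proj₂ (two zero)) (sym (proj₂ (two i)))))

IsAssignmentOfSizeAtLeast : (G : Graph) → ℕ → ListAssignment G → Set
IsAssignmentOfSizeAtLeast G k L = ∀ v → Unique (L v) × k ≤ length (L v)

take-drop-separated : ∀ {xs : List ℕ} k → Unique xs → suc (suc k) ≤ length xs →
  ∃ λ x → x ∈ take (suc k) xs × x ∉ take (suc k) (drop 1 xs)
take-drop-separated {x ∷ xs} k (x≢xs ∷ _) _ =
  x , here refl , λ x∈ → All.lookup x≢xs (∈-take⁻ (suc k) xs x∈) refl

-- If every non-colorable (k+1)-assignment is constant, a non-colorable assignment with
-- longer lists cannot exist: trimming a long list in two different ways gives two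
-- non-colorable (k+1)-assignments that cannot both be constant.
module _ (G : Graph) (_≟ᵥ_ : DecidableEquality (V G)) {p q : V G} (p≢q : p ≢ q) (k : ℕ)
         (constantₖ : NonColorableAssignmentsConstant G (suc (suc k)))
         (L : ListAssignment G) (atLeast : IsAssignmentOfSizeAtLeast G (suc k) L)
         (nc : ¬ LColorable G L) where

  private
    trimAfter : (V G → ℕ) → ListAssignment G
    trimAfter d v = take (suc k) (drop (d v) (L v))

    trimAfter-constant : ∀ d → (∀ v → d v + suc k ≤ length (L v)) → Constant G (trimAfter d)
    trimAfter-constant d fits = constantₖ (trimAfter d) size λ (c , c∈ , proper) →
      nc (c , (λ v → ∈-drop⁻ (d v) (L v) (∈-take⁻ (suc k) _ (c∈ v))) , proper)
      where
      open ≡-Reasoning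
      size : IsAssignmentOfSize G (suc k) (trimAfter d)
      size v = take⁺ (suc k) (drop⁺ (d v) (proj₁ (atLeast v))) , (begin
        length (take (suc k) (drop (d v) (L v))) ≡⟨ length-take (suc k) (drop (d v) (L v)) ⟩
        suc k ⊓ length (drop (d v) (L v))        ≡⟨ cong (suc k ⊓_) (length-drop (d v) (L v)) ⟩
        suc k ⊓ (length (L v) ∸ d v)             ≡⟨ m≤n⇒m⊓n≡m (m+n≤o⇒m≤o∸n (suc k) k+1≤ ) ⟩
        suc k                                    ∎)
        where
        k+1≤ : suc k + d v ≤ length (L v)
        k+1≤ = subst (_≤ length (L v)) (+-comm (d v) (suc k)) (fits v)

    untrimmed : ∀ v → 0 + suc k ≤ length (L v)
    untrimmed v = proj₂ (atLeast v)

    otherVertex : ∀ w → ∃ λ z → z ≢ w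
    otherVertex w with w ≟ᵥ p
    ... | yes refl = q , ≢-sym p≢q
    ... | no  w≢p  = p , ≢-sym w≢p

    dropAt : V G → V G → ℕ
    dropAt w v with v ≟ᵥ w
    ... | yes _ = 1
    ... | no  _ = 0

    dropAt-self : ∀ w → dropAt w w ≡ 1
    dropAt-self w with w ≟ᵥ w
    ... | yes _   = refl
    ... | no  w≢w = contradiction refl w≢w

    dropAt-other : ∀ {w z} → z ≢ w → dropAt w z ≡ 0
    dropAt-other {w} {z} z≢w with z ≟ᵥ w
    ... | yes z≡w = contradiction z≡w z≢w
    ... | no  _   = refl

    dropAt-fits : ∀ w → suc k < length (L w) → ∀ v → dropAt w v + suc k ≤ length (L v)
    dropAt-fits w long v with v ≟ᵥ w
    ... | yes refl = long
    ... | no  _    = untrimmed v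

    short : ∀ w → length (L w) ≤ suc k
    short w = ≮⇒≥ λ long →
      let x , x∈ , x∉ = take-drop-separated k (proj₁ (atLeast w)) long
          z , z≢w = otherVertex w
          x∈z = Equivalence.to (trimAfter-constant (λ _ → 0) untrimmed w z x) x∈
          x∈w = Equivalence.to (trimAfter-constant (dropAt w) (dropAt-fits w long) z w x)
                  (subst (λ d → x ∈ take (suc k) (drop d (L z))) (sym (dropAt-other z≢w)) x∈z)
      in x∉ (subst (λ d → x ∈ take (suc k) (drop d (L w))) (dropAt-self w) x∈w)

  nonColorable-atLeast⇒constant : IsAssignmentOfSize G (suc k) L × Constant G L
  nonColorable-atLeast⇒constant =
    (λ v → proj₁ (atLeast v) , ≤-antisym (short v) (proj₂ (atLeast v))) ,
    λ u v x → subst₂ (λ A B → (x ∈ A) ⇔ (x ∈ B))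
      (take-all (suc k) (L u) (short u)) (take-all (suc k) (L v) (short v))
      (trimAfter-constant (λ _ → 0) untrimmed u v x)

-- Three lists covering all pairs of two disjoint lists

indicator : {P : Set} → Dec P → ℕ
indicator (yes _) = 1
indicator (no  _) = 0

length-filter-∷ : {P : ℕ → Set} (P? : ∀ x → Dec (P x)) (z : ℕ) (Z : List ℕ) →
  length (filter P? (z ∷ Z)) ≡ indicator (P? z) + length (filter P? Z)
length-filter-∷ P? z Z with P? z
... | yes _ = refl
... | no  _ = refl

module DoubleCounting (S₁ S₂ S₃ : List ℕ) where

  Covered : ℕ → ℕ → Set
  Covered a b = (a ∈ S₁ × b ∈ S₁) ⊎ (a ∈ S₂ × b ∈ S₂) ⊎ (a ∈ S₃ × b ∈ S₃)

  Covered-sym : ∀ {a b} → Covered a b → Covered b a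
  Covered-sym = Data.Sum.map swap (Data.Sum.map swap swap)

  hits : ℕ → ℕ
  hits z = indicator (z ∈? S₁) + indicator (z ∈? S₂) + indicator (z ∈? S₃)

  incidences : List ℕ → ℕ
  incidences Z = length (filter (_∈? S₁) Z) + length (filter (_∈? S₂) Z) + length (filter (_∈? S₃) Z)

  incidences-∷ : ∀ z Z → incidences (z ∷ Z) ≡ hits z + incidences Z
  incidences-∷ z Z = trans
    (cong₂ _+_ (cong₂ _+_ (length-filter-∷ (_∈? S₁) z Z) (length-filter-∷ (_∈? S₂) z Z))
               (length-filter-∷ (_∈? S₃) z Z))
    (regroup (indicator (z ∈? S₁)) (indicator (z ∈? S₂)) (indicator (z ∈? S₃)) _ _ _)
    where
    regroup : ∀ i₁ i₂ i₃ f₁ f₂ f₃ → (i₁ + f₁) + (i₂ + f₂) + (i₃ + f₃) ≡ (i₁ + i₂ + i₃) + (f₁ + f₂ + f₃)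
    regroup = solve-∀

  incidences-≥ : ∀ Z → (∀ {z} → z ∈ Z → 2 ≤ hits z) → length Z + length Z ≤ incidences Z
  incidences-≥ []      _     = z≤n
  incidences-≥ (z ∷ Z) twice = begin
    suc (length Z) + suc (length Z) ≡⟨ +-suc (suc (length Z)) (length Z) ⟩
    2 + (length Z + length Z)       ≤⟨ +-mono-≤ (twice (here refl)) (incidences-≥ Z (twice ∘ there)) ⟩
    hits z + incidences Z           ≡⟨ incidences-∷ z Z ⟨
    incidences (z ∷ Z)              ∎
    where open ≤-Reasoning

  incidences-≤ : ∀ {Z s} → Unique Z → length S₁ ≤ s → length S₂ ≤ s → length S₃ ≤ s →
    incidences Z ≤ s + s + s
  incidences-≤ {Z} !Z |S₁| |S₂| |S₃| =
    +-mono-≤ (+-mono-≤ (bound S₁ |S₁|) (bound S₂ |S₂|)) (bound S₃ |S₃|)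
    where
    bound : ∀ S {s} → length S ≤ s → length (filter (_∈? S) Z) ≤ s
    bound S |S| =
      ≤-trans (Unique-⊆⇒length-≤ (filter⁺ (_∈? S) !Z) (proj₂ ∘ ∈-filter⁻ (_∈? S) {xs = Z})) |S|

  tooLong : ∀ {z : ℕ} {W S} → Unique W → z ∉ W → z ∈ S → length S ≤ length W → W ⊆ S → ⊥
  tooLong !W z∉W z∈S |S| W⊆S = 1+n≰n (≤-trans (Unique-∉-⊆⇒length-< !W z∉W z∈S W⊆S) |S|)

  -- A color outside W lying in at most one Sᵢ forces W ⊆ Sᵢ, and then Sᵢ is too long.
  hits≥2 : ∀ {z W} → Unique W → z ∉ W → ∃ (_∈ W) →
    length S₁ ≤ length W → length S₂ ≤ length W → length S₃ ≤ length W →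
    (∀ {b} → b ∈ W → Covered z b) → 2 ≤ hits z
  hits≥2 {z} {W} !W z∉W (b , b∈W) |S₁| |S₂| |S₃| cover with z ∈? S₁ | z ∈? S₂ | z ∈? S₃
  ... | yes _   | yes _   | _       = s≤s (s≤s z≤n)
  ... | yes _   | no  _   | yes _   = s≤s (s≤s z≤n)
  ... | no  _   | yes _   | yes _   = s≤s (s≤s z≤n)
  ... | yes z∈₁ | no  z∉₂ | no  z∉₃ =
    ⊥-elim (tooLong !W z∉W z∈₁ |S₁| λ b∈ →
      [ proj₂ , [ ⊥-elim ∘ z∉₂ ∘ proj₁ , ⊥-elim ∘ z∉₃ ∘ proj₁ ] ] (cover b∈))
  ... | no  z∉₁ | yes z∈₂ | no  z∉₃ =
    ⊥-elim (tooLong !W z∉W z∈₂ |S₂| λ b∈ →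
      [ ⊥-elim ∘ z∉₁ ∘ proj₁ , [ proj₂ , ⊥-elim ∘ z∉₃ ∘ proj₁ ] ] (cover b∈))
  ... | no  z∉₁ | no  z∉₂ | yes z∈₃ =
    ⊥-elim (tooLong !W z∉W z∈₃ |S₃| λ b∈ →
      [ ⊥-elim ∘ z∉₁ ∘ proj₁ , [ ⊥-elim ∘ z∉₂ ∘ proj₁ , proj₂ ] ] (cover b∈))
  ... | no  z∉₁ | no  z∉₂ | no  z∉₃ =
    ⊥-elim ([ z∉₁ ∘ proj₁ , [ z∉₂ ∘ proj₁ , z∉₃ ∘ proj₁ ] ] (cover b∈W))

  no-covering : ∀ {s X Y} → Unique X → Unique Y → Disjoint X Y →
    length X ≡ suc s → length Y ≡ suc s →
    length S₁ ≤ suc s → length S₂ ≤ suc s → length S₃ ≤ suc s →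
    (∀ {a b} → a ∈ X → b ∈ Y → Covered a b) → ⊥
  no-covering {s} {X} {Y} !X !Y X∩Y=∅ |X| |Y| |S₁| |S₂| |S₃| cover =
    m+1+n≰m (t + t + t) (begin
      t + t + t + t              ≡⟨ regroup ⟩
      length Z + length Z        ≤⟨ incidences-≥ Z inZ-twice ⟩
      incidences Z               ≤⟨ incidences-≤ !Z |S₁| |S₂| |S₃| ⟩
      t + t + t                  ∎)
    where
    open ≤-Reasoning
    t = suc s
    Z = X ++ Y
    !Z : Unique Z
    !Z = ++⁺ !X !Y X∩Y=∅
    regroup : t + t + t + t ≡ length Z + length Z
    regroup = trans (four t) (cong₂ _+_ |Z| |Z|)
      where
      four : ∀ t → t + t + t + t ≡ (t + t) + (t + t)
      four = solve-∀
      |Z| : t + t ≡ length Z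
      |Z| = sym (trans (length-++ X) (cong₂ _+_ |X| |Y|))
    member : ∀ {W : List ℕ} → length W ≡ suc s → ∃ (_∈ W)
    member {w ∷ _} _ = w , here refl
    ≤|W| : ∀ W S → length S ≤ suc s → length W ≡ suc s → length S ≤ length W
    ≤|W| _ _ |S| |W| = ≤-trans |S| (≤-reflexive (sym |W|))
    inZ-twice : ∀ {z} → z ∈ Z → 2 ≤ hits z
    inZ-twice z∈Z with ∈-++⁻ X z∈Z
    ... | inj₁ z∈X = hits≥2 !Y (λ z∈Y → X∩Y=∅ (z∈X , z∈Y)) (member |Y|)
                       (≤|W| Y S₁ |S₁| |Y|) (≤|W| Y S₂ |S₂| |Y|) (≤|W| Y S₃ |S₃| |Y|) (cover z∈X)
    ... | inj₂ z∈Y = hits≥2 !X (λ z∈X → X∩Y=∅ (z∈X , z∈Y)) (member |X|)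
                       (≤|W| X S₁ |S₁| |X|) (≤|W| X S₂ |S₂| |X|) (≤|W| X S₃ |S₃| |X|)
                       (λ a∈X → Covered-sym (cover a∈X z∈Y))

G₀-nonColorableAssignmentsConstant : ∀ l m → NonColorableAssignmentsConstant (G l m 0) 3
G₀-nonColorableAssignmentsConstant l m L two nc (inj₁ i) (inj₁ j) =
  Cycle-nonColorableAssignmentsConstant (l + l) (L ∘ inj₁) (two ∘ inj₁) onCycle i j
  where
  onCycle : ¬ LColorable (Cycle (l + l)) (L ∘ inj₁)
  onCycle (c , c∈ , proper) = nc
    ( (λ { (inj₁ i) → c i ; (inj₂ (inj₁ ())) ; (inj₂ (inj₂ ())) })
    , (λ { (inj₁ i) → c∈ i ; (inj₂ (inj₁ ())) ; (inj₂ (inj₂ ())) })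
    , λ { (inj₁ i) (inj₁ j) → proper i j
        ; (inj₁ _) (inj₂ (inj₁ ())) ; (inj₁ _) (inj₂ (inj₂ ()))
        ; (inj₂ (inj₁ ())) _ ; (inj₂ (inj₂ ())) _ })
G₀-nonColorableAssignmentsConstant l m L two nc (inj₁ _) (inj₂ (inj₁ ()))
G₀-nonColorableAssignmentsConstant l m L two nc (inj₁ _) (inj₂ (inj₂ ()))
G₀-nonColorableAssignmentsConstant l m L two nc (inj₂ (inj₁ ())) _
G₀-nonColorableAssignmentsConstant l m L two nc (inj₂ (inj₂ ())) _

-- From G l m k to G l m (k + 1)

module Step (l m k : ℕ) (2+m≤n : 2 + m ≤ l + l) (4≤n : 4 ≤ l + l) (m≤3 : m ≤ 3)
            (constantₖ : NonColorableAssignmentsConstant (G l m k) (3 + k)) where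

  G⁺ : Graph
  G⁺ = G l m (suc k)

  lift : GVertex l k → GVertex l (suc k)
  lift (inj₁ i)        = inj₁ i
  lift (inj₂ (inj₁ a)) = inj₂ (inj₁ (suc a))
  lift (inj₂ (inj₂ a)) = inj₂ (inj₂ (suc a))

  u₀ s₀ : GVertex l (suc k)
  u₀ = inj₂ (inj₁ zero)
  s₀ = inj₂ (inj₂ zero)

  byVertex : (P : GVertex l (suc k) → Set) → P u₀ → P s₀ → (∀ v → P (lift v)) → ∀ w → P w
  byVertex P pu ps pl (inj₁ i)              = pl (inj₁ i)
  byVertex P pu ps pl (inj₂ (inj₁ zero))    = pu
  byVertex P pu ps pl (inj₂ (inj₁ (suc a))) = pl (inj₂ (inj₁ a))
  byVertex P pu ps pl (inj₂ (inj₂ zero))    = ps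
  byVertex P pu ps pl (inj₂ (inj₂ (suc a))) = pl (inj₂ (inj₂ a))

  NearU NearS : GVertex l k → Set
  NearU v = Adj G⁺ u₀ (lift v)
  NearS v = Adj G⁺ s₀ (lift v)

  nearU? : ∀ v → Dec (NearU v)
  nearU? (inj₁ i)        = (toℕ i <? 2 + m) ⊎-dec no λ ()
  nearU? (inj₂ (inj₁ _)) = yes (inj₂ (s≤s z≤n))
  nearU? (inj₂ (inj₂ _)) = no [ (λ ()) , (λ ()) ]

  nearS? : ∀ v → Dec (NearS v)
  nearS? (inj₁ i)        = (2 ≤? toℕ i) ⊎-dec no λ ()
  nearS? (inj₂ (inj₁ _)) = no [ (λ ()) , (λ ()) ]
  nearS? (inj₂ (inj₂ _)) = yes (inj₂ (s≤s z≤n))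

  Common : Fin (suc (l + l)) → Set
  Common i = 2 ≤ toℕ i × toℕ i < 2 + m

  nearBoth⇒common : ∀ {v} → NearU v → NearS v → ∃ λ i → v ≡ inj₁ i × Common i
  nearBoth⇒common {inj₁ i} (inj₁ i<2+m) (inj₁ 2≤i) = i , refl , 2≤i , i<2+m
  nearBoth⇒common {inj₂ (inj₁ _)} _ (inj₁ ())
  nearBoth⇒common {inj₂ (inj₁ _)} _ (inj₂ ())
  nearBoth⇒common {inj₂ (inj₂ _)} (inj₁ ()) _
  nearBoth⇒common {inj₂ (inj₂ _)} (inj₂ ()) _

  v₀ vₙ : GVertex l k
  v₀ = inj₁ zero
  vₙ = inj₁ (fromℕ (l + l))

  v₀-nearU : NearU v₀
  v₀-nearU = inj₁ (s≤s z≤n)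

  v₀-¬nearS : ¬ NearS v₀
  v₀-¬nearS = [ (λ ()) , (λ ()) ]

  vₙ-nearS : NearS vₙ
  vₙ-nearS = inj₁ (subst (2 ≤_) (sym (toℕ-fromℕ (l + l))) (≤-trans (s≤s (s≤s z≤n)) 2+m≤n))

  vₙ-¬nearU : ¬ NearU vₙ
  vₙ-¬nearU = [ (λ n<2+m → 1+n≰n (≤-trans (subst (_< 2 + m) (toℕ-fromℕ (l + l)) n<2+m) 2+m≤n)) , (λ ()) ]

  v₀≢vₙ : v₀ ≢ vₙ
  v₀≢vₙ v₀≡vₙ with cong [ toℕ , (λ _ → 0) ] v₀≡vₙ
  ... | 0≡n = 1+n≰n (≤-trans (≤-trans (s≤s z≤n) 2+m≤n)
                              (≤-reflexive (trans (sym (toℕ-fromℕ (l + l))) (sym 0≡n))))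

  constantₖ-atLeast : ∀ L → IsAssignmentOfSizeAtLeast (G l m k) (2 + k) L → ¬ LColorable (G l m k) L →
    IsAssignmentOfSize (G l m k) (2 + k) L × Constant (G l m k) L
  constantₖ-atLeast = nonColorable-atLeast⇒constant (G l m k)
    (≡-dec Data.Fin._≟_ (≡-dec Data.Fin._≟_ Data.Fin._≟_)) v₀≢vₙ (suc k) constantₖ

  extend : ℕ → ℕ → (GVertex l k → ℕ) → GVertex l (suc k) → ℕ
  extend a b c = byVertex (λ _ → ℕ) a b c

  extend-proper : ∀ {a b c} → Proper (G l m k) c →
    (∀ v → NearU v → c v ≢ a) → (∀ v → NearS v → c v ≢ b) → Proper G⁺ (extend a b c)
  extend-proper {a} {b} {c} proper avoidA avoidB = fromOriented oriented
    where
    oriented : ∀ x y → GRel l m (suc k) x y → extend a b c x ≢ extend a b c y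
    oriented (inj₁ i)              (inj₁ j)              e       = proper (inj₁ i) (inj₁ j) (inj₁ e)
    oriented (inj₂ (inj₁ zero))    (inj₁ i)              e       = avoidA (inj₁ i) (inj₁ e) ∘ sym
    oriented (inj₂ (inj₁ (suc x))) (inj₁ i)              e       = proper _ _ (inj₁ e)
    oriented (inj₂ (inj₂ zero))    (inj₁ i)              e       = avoidB (inj₁ i) (inj₁ e) ∘ sym
    oriented (inj₂ (inj₂ (suc x))) (inj₁ i)              e       = proper _ _ (inj₁ e)
    oriented (inj₂ (inj₁ (suc x))) (inj₂ (inj₁ zero))    _       = avoidA _ (inj₂ (s≤s z≤n))
    oriented (inj₂ (inj₁ (suc x))) (inj₂ (inj₁ (suc y))) (s≤s e) = proper _ _ (inj₁ e)
    oriented (inj₂ (inj₂ (suc x))) (inj₂ (inj₂ zero))    _       = avoidB _ (inj₂ (s≤s z≤n))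
    oriented (inj₂ (inj₂ (suc x))) (inj₂ (inj₂ (suc y))) (s≤s e) = proper _ _ (inj₁ e)
    oriented (inj₂ (inj₁ zero))    (inj₂ (inj₁ _))       ()
    oriented (inj₂ (inj₂ zero))    (inj₂ (inj₂ _))       ()
    oriented (inj₁ _)              (inj₂ _)              ()
    oriented (inj₂ (inj₁ _))       (inj₂ (inj₂ _))       ()
    oriented (inj₂ (inj₂ _))       (inj₂ (inj₁ _))       ()

  module _ (L : ListAssignment G⁺) (sized : IsAssignmentOfSize G⁺ (3 + k) L)
           (nc : ¬ LColorable G⁺ L) where

    -- Color u₀ with a and s₀ with b, and delete a from the other neighbours of u₀ and b from
    -- the other neighbours of s₀; a common neighbour containing both would lose two colors.
    module Reduction {a b : ℕ} (a∈ : a ∈ L u₀) (b∈ : b ∈ L s₀)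
                     (compatible : ∀ i → Common i → a ∈ L (inj₁ i) → b ∈ L (inj₁ i) → a ≡ b) where

      Rejected : GVertex l k → ℕ → Set
      Rejected v x = (NearU v × x ≡ a) ⊎ (NearS v × x ≡ b)

      rejected? : ∀ v x → Dec (Rejected v x)
      rejected? v x = (nearU? v ×-dec x ≟ a) ⊎-dec (nearS? v ×-dec x ≟ b)

      reduced : ListAssignment (G l m k)
      reduced v = filter (¬? ∘ rejected? v) (L (lift v))

      ∈-reduced⁺ : ∀ v {x} → x ∈ L (lift v) × ¬ Rejected v x → x ∈ reduced v
      ∈-reduced⁺ v (x∈ , kept) = ∈-filter⁺ (¬? ∘ rejected? v) x∈ kept

      ∈-reduced⁻ : ∀ v {x} → x ∈ reduced v → x ∈ L (lift v) × ¬ Rejected v x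
      ∈-reduced⁻ v = ∈-filter⁻ (¬? ∘ rejected? v)

      rejectsOne : ∀ {v x y} → x ∈ L (lift v) → y ∈ L (lift v) → Rejected v x → Rejected v y → x ≡ y
      rejectsOne _   _   (inj₁ (_ , refl)) (inj₁ (_ , refl)) = refl
      rejectsOne _   _   (inj₂ (_ , refl)) (inj₂ (_ , refl)) = refl
      rejectsOne x∈ y∈ (inj₁ (u , refl)) (inj₂ (s , refl)) = nearBoth u s x∈ y∈
        where
        nearBoth : ∀ {v} → NearU v → NearS v → a ∈ L (lift v) → b ∈ L (lift v) → a ≡ b
        nearBoth u s with nearBoth⇒common u s
        ... | i , refl , common = compatible i common
      rejectsOne x∈ y∈ (inj₂ (s , refl)) (inj₁ (u , refl)) =
        sym (rejectsOne y∈ x∈ (inj₁ (u , refl)) (inj₂ (s , refl)))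

      reduced-atLeast : IsAssignmentOfSizeAtLeast (G l m k) (2 + k) reduced
      reduced-atLeast v = filter⁺ (¬? ∘ rejected? v) !Lv , s≤s⁻¹ (begin
        suc (2 + k)                  ≡⟨ proj₂ (sized (lift v)) ⟨
        length (L (lift v))          ≤⟨ length-filter-rejectingOne (¬? ∘ rejected? v) !Lv
                                          (λ x∈ y∈ ¬kx ¬ky → rejectsOne x∈ y∈
                                             (decidable-stable (rejected? v _) ¬kx)
                                             (decidable-stable (rejected? v _) ¬ky)) ⟩
        suc (length (reduced v))     ∎)
        where
        open ≤-Reasoning
        !Lv = proj₁ (sized (lift v))

      reduced-nonColorable : ¬ LColorable (G l m k) reduced
      reduced-nonColorable (c , c∈ , proper) =
        nc (extend a b c , extend∈ ,
            extend-proper proper (λ v u → kept v ∘ inj₁ ∘ (u ,_)) (λ v s → kept v ∘ inj₂ ∘ (s ,_)))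
        where
        kept : ∀ v → ¬ Rejected v (c v)
        kept v = proj₂ (∈-reduced⁻ v (c∈ v))
        extend∈ : ∀ w → extend a b c w ∈ L w
        extend∈ (inj₁ i)              = proj₁ (∈-reduced⁻ (inj₁ i) (c∈ (inj₁ i)))
        extend∈ (inj₂ (inj₁ zero))    = a∈
        extend∈ (inj₂ (inj₁ (suc x))) = proj₁ (∈-reduced⁻ (inj₂ (inj₁ x)) (c∈ (inj₂ (inj₁ x))))
        extend∈ (inj₂ (inj₂ zero))    = b∈
        extend∈ (inj₂ (inj₂ (suc x))) = proj₁ (∈-reduced⁻ (inj₂ (inj₂ x)) (c∈ (inj₂ (inj₂ x))))

      tight : IsAssignmentOfSize (G l m k) (2 + k) reduced × Constant (G l m k) reduced
      tight = constantₖ-atLeast reduced reduced-atLeast reduced-nonColorable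

      someRejected : ∀ v → ¬ All (λ x → ¬ Rejected v x) (L (lift v))
      someRejected v allKept = 1+n≰n (≤-reflexive (begin
        suc (2 + k)              ≡⟨ proj₂ (sized (lift v)) ⟨
        length (L (lift v))      ≡⟨ cong length (filter-all (¬? ∘ rejected? v) allKept) ⟨
        length (reduced v)       ≡⟨ proj₂ (proj₁ tight v) ⟩
        2 + k                    ∎))
        where open ≡-Reasoning

      loses : ∀ v → (NearU v × a ∈ L (lift v)) ⊎ (NearS v × b ∈ L (lift v))
      loses v with find (¬All⇒Any¬ (¬? ∘ rejected? v) (L (lift v)) (someRejected v))
      ... | x , x∈ , ¬kept with decidable-stable (rejected? v x) ¬kept
      ...   | inj₁ (u , refl) = inj₁ (u , x∈)
      ...   | inj₂ (s , refl) = inj₂ (s , x∈)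

      transfer : ∀ v w {x} → x ∈ L (lift v) → ¬ Rejected v x → x ∈ L (lift w) × ¬ Rejected w x
      transfer v w x∈ kept = ∈-reduced⁻ w (Equivalence.to (proj₂ tight v w _) (∈-reduced⁺ v (x∈ , kept)))

      a∈v₀ : a ∈ L (lift v₀)
      a∈v₀ = [ proj₂ , ⊥-elim ∘ v₀-¬nearS ∘ proj₁ ] (loses v₀)

      b∈vₙ : b ∈ L (lift vₙ)
      b∈vₙ = [ ⊥-elim ∘ vₙ-¬nearU ∘ proj₁ , proj₂ ] (loses vₙ)

    X Y : List ℕ
    X = L u₀
    Y = L s₀

    module SharedColor {c} (c∈X : c ∈ X) (c∈Y : c ∈ Y) where

      open Reduction c∈X c∈Y (λ _ _ _ _ → refl)

      Λ : List ℕ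
      Λ = L (lift v₀)

      lifted-⊆ : ∀ v w → L (lift v) ⊆ L (lift w)
      lifted-⊆ v w {x} x∈ with x ≟ c
      ... | yes refl = [ proj₂ , proj₂ ] (loses w)
      ... | no  x≢c  = proj₁ (transfer v w x∈ [ x≢c ∘ proj₂ , x≢c ∘ proj₂ ])

      -- A color of X outside Λ could be used at u₀ together with c at s₀.
      X⊆Λ : X ⊆ Λ
      X⊆Λ {x} x∈X with x ∈? Λ
      ... | yes x∈Λ = x∈Λ
      ... | no  x∉Λ = ⊥-elim (x∉Λ
                        (Reduction.a∈v₀ x∈X c∈Y λ i _ x∈ _ → ⊥-elim (x∉Λ (lifted-⊆ (inj₁ i) v₀ x∈))))

      Y⊆Λ : Y ⊆ Λ
      Y⊆Λ {y} y∈Y with y ∈? Λ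
      ... | yes y∈Λ = y∈Λ
      ... | no  y∉Λ = ⊥-elim (y∉Λ (lifted-⊆ vₙ v₀
                        (Reduction.b∈vₙ c∈X y∈Y λ i _ _ y∈ → ⊥-elim (y∉Λ (lifted-⊆ (inj₁ i) v₀ y∈)))))

      ⊆Λ⇒Λ⊆ : ∀ w → L w ⊆ Λ → Λ ⊆ L w
      ⊆Λ⇒Λ⊆ w Lw⊆Λ = Unique-⊆-length⇒⊇ _≟_ (proj₁ (sized w)) Lw⊆Λ
        (≤-reflexive (trans (proj₂ (sized (lift v₀))) (sym (proj₂ (sized w)))))

      constant : Constant G⁺ L
      constant = constant-viaRoot G⁺ L (lift v₀)
        (byVertex (λ w → L w ⊆ Λ) X⊆Λ Y⊆Λ (λ v → lifted-⊆ v v₀))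
        (byVertex (λ w → Λ ⊆ L w) (⊆Λ⇒Λ⊆ u₀ X⊆Λ) (⊆Λ⇒Λ⊆ s₀ Y⊆Λ) (lifted-⊆ v₀))

    Clash : ℕ → ℕ → Set
    Clash a b = ∃ λ i → Common i × a ∈ L (inj₁ i) × b ∈ L (inj₁ i)

    clash? : ∀ a b → Dec (Clash a b)
    clash? a b = Data.Fin.Properties.any? λ i →
      ((2 ≤? toℕ i) ×-dec (toℕ i <? 2 + m)) ×-dec (a ∈? L (inj₁ i)) ×-dec (b ∈? L (inj₁ i))

    ¬clash⇒compatible : ∀ {a b} → ¬ Clash a b → ∀ i → Common i → a ∈ L (inj₁ i) → b ∈ L (inj₁ i) → a ≡ b
    ¬clash⇒compatible ¬clash i common a∈ b∈ = ⊥-elim (¬clash (i , common , a∈ , b∈))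

    module Disjoint (X∩Y=∅ : Disjoint X Y) where

      distinct : ∀ {x y} → x ∈ X → y ∈ Y → x ≢ y
      distinct x∈X y∈Y refl = X∩Y=∅ (x∈X , y∈Y)

      -- With a compatible pair (a , b), every other color of X and of Y survives in the
      -- reduced list at v₀, which has only 2 + k colors.
      module CompatiblePair {a b} (a∈X : a ∈ X) (b∈Y : b ∈ Y) (¬clash : ¬ Clash a b) where

        open Reduction a∈X b∈Y (¬clash⇒compatible ¬clash)

        X∖a⊆ : ∀ {x} → x ∈ X → x ≢ a → x ∈ reduced v₀
        X∖a⊆ {x} x∈X x≢a with clash? x b
        ... | yes (i , _ , x∈ , _) =
          ∈-reduced⁺ v₀ (transfer (inj₁ i) v₀ x∈ [ x≢a ∘ proj₂ , distinct x∈X b∈Y ∘ proj₂ ])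
        ... | no ¬clash′ =
          ⊥-elim (proj₂ (transfer vₙ v₀ (proj₁ a∈vₙ)
                          [ vₙ-¬nearU ∘ proj₁ , distinct a∈X b∈Y ∘ proj₂ ])
                   (inj₁ (v₀-nearU , refl)))
          where
          module R′ = Reduction x∈X b∈Y (¬clash⇒compatible ¬clash′)
          a∈vₙ = R′.transfer v₀ vₙ a∈v₀ [ x≢a ∘ sym ∘ proj₂ , v₀-¬nearS ∘ proj₁ ]

        Y∖b⊆ : ∀ {y} → y ∈ Y → y ≢ b → y ∈ reduced v₀
        Y∖b⊆ {y} y∈Y y≢b with clash? a y
        ... | yes (i , _ , _ , y∈) =
          ∈-reduced⁺ v₀ (transfer (inj₁ i) v₀ y∈ [ distinct a∈X y∈Y ∘ sym ∘ proj₂ , y≢b ∘ proj₂ ])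
        ... | no ¬clash′ =
          ⊥-elim (proj₂ (transfer v₀ vₙ (proj₁ b∈v₀)
                          [ distinct a∈X b∈Y ∘ sym ∘ proj₂ , v₀-¬nearS ∘ proj₁ ])
                   (inj₂ (vₙ-nearS , refl)))
          where
          module R′ = Reduction a∈X y∈Y (¬clash⇒compatible ¬clash′)
          b∈v₀ = R′.transfer vₙ v₀ b∈vₙ [ vₙ-¬nearU ∘ proj₁ , y≢b ∘ sym ∘ proj₂ ]

        impossible : ⊥
        impossible = m+1+n≰m (2 + k) (begin
          (2 + k) + (2 + k)          ≤⟨ +-mono-≤ (long X a (sized u₀)) (long Y b (sized s₀)) ⟩
          length X∖a + length Y∖b    ≡⟨ length-++ X∖a ⟨
          length (X∖a ++ Y∖b)        ≤⟨ Unique-⊆⇒length-≤ !X∖a++Y∖b X∖a++Y∖b⊆ ⟩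
          length (reduced v₀)        ≡⟨ proj₂ (proj₁ tight v₀) ⟩
          2 + k                      ∎)
          where
          open ≤-Reasoning
          X∖a Y∖b : List ℕ
          X∖a = filter (¬? ∘ (_≟ a)) X
          Y∖b = filter (¬? ∘ (_≟ b)) Y
          long : ∀ W z → Unique W × length W ≡ 3 + k → 2 + k ≤ length (filter (¬? ∘ (_≟ z)) W)
          long W z (!W , |W|) =
            s≤s⁻¹ (subst (_≤ suc (length (filter (¬? ∘ (_≟ z)) W))) |W| (length-filter-≢ _≟_ z !W))
          !X∖a++Y∖b : Unique (X∖a ++ Y∖b)
          !X∖a++Y∖b = ++⁺ (filter⁺ _ (proj₁ (sized u₀))) (filter⁺ _ (proj₁ (sized s₀)))
            λ (x∈ , y∈) → X∩Y=∅ (proj₁ (∈-filter⁻ (¬? ∘ (_≟ a)) x∈) , proj₁ (∈-filter⁻ (¬? ∘ (_≟ b)) y∈))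
          X∖a++Y∖b⊆ : X∖a ++ Y∖b ⊆ reduced v₀
          X∖a++Y∖b⊆ z∈ with ∈-++⁻ X∖a z∈
          ... | inj₁ z∈X∖a = uncurry X∖a⊆ (∈-filter⁻ (¬? ∘ (_≟ a)) z∈X∖a)
          ... | inj₂ z∈Y∖b = uncurry Y∖b⊆ (∈-filter⁻ (¬? ∘ (_≟ b)) z∈Y∖b)

      -- Otherwise every pair clashes at one of the common neighbours v₂, v₃, v₄, which is
      -- impossible by double counting.
      module AllClash (clash : ∀ {a b} → a ∈ X → b ∈ Y → Clash a b) where

        at : (t : ℕ) → .(t ≤ 4) → Fin (suc (l + l))
        at t t≤4 = fromℕ< (s≤s (≤-trans t≤4 4≤n))

        open DoubleCounting (L (inj₁ (at 2 (s≤s (s≤s z≤n))))) (L (inj₁ (at 3 (s≤s (s≤s (s≤s z≤n))))))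
                            (L (inj₁ (at 4 ≤-refl)))

        two-to-four : ∀ {t} → 2 ≤ t → t < 2 + m → t ≡ 2 ⊎ t ≡ 3 ⊎ t ≡ 4
        two-to-four {0} ()
        two-to-four {1} (s≤s ())
        two-to-four {2} _ _ = inj₁ refl
        two-to-four {3} _ _ = inj₂ (inj₁ refl)
        two-to-four {4} _ _ = inj₂ (inj₂ refl)
        two-to-four {suc (suc (suc (suc (suc t))))} _ t<2+m with ≤-trans t<2+m (s≤s (s≤s m≤3))
        ... | s≤s (s≤s (s≤s (s≤s (s≤s ()))))

        ≡at : ∀ {i t} .(t≤4 : t ≤ 4) → toℕ i ≡ t → i ≡ at t t≤4
        ≡at t≤4 i≡t = toℕ-injective (trans i≡t (sym (toℕ-fromℕ< _)))

        covered : ∀ {a b} → a ∈ X → b ∈ Y → Covered a b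
        covered a∈ b∈ with clash a∈ b∈
        ... | i , (2≤i , i<2+m) , a∈i , b∈i with two-to-four 2≤i i<2+m
        ... | inj₁ i≡2 with refl ← ≡at (s≤s (s≤s z≤n)) i≡2 = inj₁ (a∈i , b∈i)
        ... | inj₂ (inj₁ i≡3) with refl ← ≡at (s≤s (s≤s (s≤s z≤n))) i≡3 = inj₂ (inj₁ (a∈i , b∈i))
        ... | inj₂ (inj₂ i≡4) with refl ← ≡at ≤-refl i≡4 = inj₂ (inj₂ (a∈i , b∈i))

        impossible : ⊥
        impossible = no-covering (proj₁ (sized u₀)) (proj₁ (sized s₀)) X∩Y=∅
          (proj₂ (sized u₀)) (proj₂ (sized s₀))
          (≤-reflexive (proj₂ (sized _))) (≤-reflexive (proj₂ (sized _))) (≤-reflexive (proj₂ (sized _)))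
          covered

      impossible : ⊥
      impossible with all? (λ a → all? (clash? a) Y) X
      ... | yes allClash = AllClash.impossible λ a∈ b∈ → All.lookup (All.lookup allClash a∈) b∈
      ... | no  ¬allClash with find (¬All⇒Any¬ (λ a → all? (clash? a) Y) X ¬allClash)
      ...   | a , a∈X , ¬all with find (¬All⇒Any¬ (clash? a) Y ¬all)
      ...     | b , b∈Y , ¬clash = CompatiblePair.impossible a∈X b∈Y ¬clash

    constant : Constant G⁺ L
    constant with any? (_∈? Y) X
    ... | yes shared = let c , c∈X , c∈Y = find shared in SharedColor.constant c∈X c∈Y
    ... | no  ¬shared = ⊥-elim (Disjoint.impossible λ (x∈X , x∈Y) → ¬shared (lose x∈X x∈Y))

  nonColorableAssignmentsConstant : NonColorableAssignmentsConstant G⁺ (4 + k)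
  nonColorableAssignmentsConstant = constant

G-nonColorableAssignmentsConstant : ∀ {l m} → 2 + m ≤ l + l → 4 ≤ l + l → m ≤ 3 →
  ∀ k → NonColorableAssignmentsConstant (G l m k) (3 + k)
G-nonColorableAssignmentsConstant {l} {m} _ _ _ zero = G₀-nonColorableAssignmentsConstant l m
G-nonColorableAssignmentsConstant {l} {m} 2+m≤n 4≤n m≤3 (suc k) =
  Step.nonColorableAssignmentsConstant l m k 2+m≤n 4≤n m≤3
    (G-nonColorableAssignmentsConstant 2+m≤n 4≤n m≤3 k)

-- Chromatic number

Colorable-weaken : ∀ {H j j′} → j ≤ j′ → Colorable H j → Colorable H j′
Colorable-weaken j≤j′ (c , proper) =
  (λ v → inject≤ (c v) j≤j′) , λ u v adj eq → proper u v adj (inject≤-injective j≤j′ j≤j′ _ _ eq)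

GRel-mono : ∀ {l m k} x y → 1 ≤ m → GRel l 1 k x y → GRel l m k x y
GRel-mono (inj₁ _)        (inj₁ _)        _   r = r
GRel-mono (inj₂ (inj₁ _)) (inj₁ _)        1≤m r = ≤-trans r (s≤s (s≤s 1≤m))
GRel-mono (inj₂ (inj₂ _)) (inj₁ _)        _   r = r
GRel-mono (inj₂ (inj₁ _)) (inj₂ (inj₁ _)) _   r = r
GRel-mono (inj₂ (inj₂ _)) (inj₂ (inj₂ _)) _   r = r
GRel-mono (inj₁ _)        (inj₂ _)        _   ()
GRel-mono (inj₂ (inj₁ _)) (inj₂ (inj₂ _)) _   ()
GRel-mono (inj₂ (inj₂ _)) (inj₂ (inj₁ _)) _   ()

Adj-mono : ∀ {l m k} x y → 1 ≤ m → Adj (G l 1 k) x y → Adj (G l m k) x y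
Adj-mono x y 1≤m = Data.Sum.map (GRel-mono x y 1≤m) (GRel-mono y x 1≤m)

∷-injective : ∀ {n} {A : Set} {y : A} {f : Fin n → A} →
  Injective _≡_ _≡_ f → (∀ i → f i ≢ y) → Injective _≡_ _≡_ (y Vector.∷ f)
∷-injective f-inj y∉f {zero}  {zero}  _  = refl
∷-injective f-inj y∉f {zero}  {suc j} eq = contradiction (sym eq) (y∉f j)
∷-injective f-inj y∉f {suc i} {zero}  eq = contradiction eq (y∉f i)
∷-injective f-inj y∉f {suc i} {suc j} eq = cong suc (f-inj eq)

clique-injective : ∀ {k} {A : Set} (h : Fin k → A) →
  (∀ {a b} → toℕ b < toℕ a → h a ≢ h b) → Injective _≡_ _≡_ h
clique-injective h distinct {a} {b} eq with <-cmp (toℕ a) (toℕ b)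
... | tri< a<b _ _ = contradiction (sym eq) (distinct a<b)
... | tri≈ _ a≡b _ = toℕ-injective a≡b
... | tri> _ _ b<a = contradiction eq (distinct b<a)

path+clique⇒ends-equal : ∀ {k} {x y z : Fin (2 + k)} (h : Fin k → Fin (2 + k)) → Injective _≡_ _≡_ h →
  (∀ a → h a ≢ x) → (∀ a → h a ≢ y) → (∀ a → h a ≢ z) → x ≢ y → y ≢ z → x ≡ z
path+clique⇒ends-equal {k} {x} {y} {z} h h-inj h≢x h≢y h≢z x≢y y≢z with x Data.Fin.≟ z
... | yes x≡z = x≡z
... | no  x≢z =
  contradiction (injective⇒≤ (∷-injective (∷-injective (∷-injective h-inj h≢x) y-new) z-new)) 1+n≰n
  where
  y-new : ∀ i → (x Vector.∷ h) i ≢ y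
  y-new zero    = x≢y
  y-new (suc a) = h≢y a
  z-new : ∀ i → (y Vector.∷ x Vector.∷ h) i ≢ z
  z-new zero          = y≢z
  z-new (suc zero)    = x≢z
  z-new (suc (suc a)) = h≢z a

G-not-colorable : ∀ l k → 1 ≤ l → ¬ Colorable (G l 1 k) (2 + k)
G-not-colorable (suc l′) k _ (c , proper) =
  proper (inj₁ (fromℕ< ≤-refl)) (inj₁ zero) (inj₁ (inj₂ (toℕ-fromℕ< ≤-refl , refl)))
    (sym (evens l′ ≤-refl))
  where
  N = suc (suc l′ + suc l′)

  below : ∀ {s t} → s ≤ t → t < N → s < N
  below s≤t t<N = ≤-trans (s≤s s≤t) t<N

  colorAt : (t : ℕ) → .(t < N) → Fin (2 + k)
  colorAt t t<N = c (inj₁ (fromℕ< t<N))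

  colorAt-cong : ∀ {t t′} .(p : t < N) .(q : t′ < N) → t ≡ t′ → colorAt t p ≡ colorAt t′ q
  colorAt-cong _ _ refl = refl

  edge : ∀ t .(q : suc t < N) → colorAt t (below (n≤1+n t) q) ≢ colorAt (suc t) q
  edge t q = proper _ _ (inj₁ (inj₁ (trans (toℕ-fromℕ< q) (cong suc (sym (toℕ-fromℕ< _))))))

  u-injective : Injective _≡_ _≡_ (c ∘ inj₂ ∘ inj₁)
  u-injective = clique-injective _ λ b<a → proper _ _ (inj₁ b<a)

  s-injective : Injective _≡_ _≡_ (c ∘ inj₂ ∘ inj₂)
  s-injective = clique-injective _ λ b<a → proper _ _ (inj₁ b<a)

  u-avoids : ∀ t .(p : t < N) → t < 3 → ∀ a → c (inj₂ (inj₁ a)) ≢ colorAt t p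
  u-avoids t p t<3 a = proper _ _ (inj₁ (subst (_< 3) (sym (toℕ-fromℕ< p)) t<3))

  s-avoids : ∀ t .(p : t < N) → 2 ≤ t → ∀ a → c (inj₂ (inj₂ a)) ≢ colorAt t p
  s-avoids t p 2≤t a = proper _ _ (inj₁ (subst (2 ≤_) (sym (toℕ-fromℕ< p)) 2≤t))

  two-steps : ∀ t .(p : 2 + t < N) → 2 ≤ t → colorAt t (below (m≤n+m t 2) p) ≡ colorAt (2 + t) p
  two-steps t p 2≤t = path+clique⇒ends-equal _ s-injective
    (s-avoids t (below (m≤n+m t 2) p) 2≤t)
    (s-avoids (1 + t) (below (n≤1+n _) p) (≤-trans 2≤t (m≤n+m t 1)))
    (s-avoids (2 + t) p (≤-trans 2≤t (m≤n+m t 2)))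
    (edge t (below (n≤1+n _) p)) (edge (1 + t) p)

  evens : ∀ t .(p : suc t + suc t < N) → colorAt 0 (below z≤n p) ≡ colorAt (suc t + suc t) p
  evens zero    p = path+clique⇒ends-equal _ u-injective
    (u-avoids 0 (below z≤n p) (s≤s z≤n))
    (u-avoids 1 (below (n≤1+n _) p) (s≤s (s≤s z≤n)))
    (u-avoids 2 p ≤-refl)
    (edge 0 (below (n≤1+n _) p)) (edge 1 p)
  evens (suc t) p =
    trans (evens t (below (+-mono-≤ (n≤1+n (suc t)) (n≤1+n (suc t))) p))
      (trans (two-steps (suc t + suc t) (subst (_< N) (sym 2+2t≡) p) (+-mono-≤ (s≤s z≤n) (s≤s z≤n)))
             (colorAt-cong (subst (_< N) (sym 2+2t≡) p) p 2+2t≡))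
    where
    2+2t≡ : 2 + (suc t + suc t) ≡ suc (suc t) + suc (suc t)
    2+2t≡ = cong suc (sym (+-suc (suc t) (suc t)))

alternate : ℕ → Fin 3
alternate zero          = zero
alternate (suc zero)    = suc zero
alternate (suc (suc t)) = alternate t

alternate-suc : ∀ t → alternate t ≢ alternate (suc t)
alternate-suc zero          ()
alternate-suc (suc zero)    ()
alternate-suc (suc (suc t)) = alternate-suc t

alternate≢2 : ∀ t → alternate t ≢ suc (suc zero)
alternate≢2 zero          ()
alternate≢2 (suc zero)    ()
alternate≢2 (suc (suc t)) = alternate≢2 t

cycleColor : (n : ℕ) → Fin (suc n) → Fin 3
cycleColor n i with toℕ i ≟ n
... | yes _ = suc (suc zero)
... | no  _ = alternate (toℕ i)

cycleColor-proper : ∀ n → 1 ≤ n → ∀ i j → CycleEdge n i j → cycleColor n i ≢ cycleColor n j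
cycleColor-proper n _ i j (inj₁ j≡1+i) with toℕ i ≟ n | toℕ j ≟ n
... | yes i≡n | _     = contradiction (subst (_< suc n) j≡1+i (toℕ<n j)) λ 1+i<1+n →
                          1+n≰n (subst (λ t → suc t ≤ n) i≡n (s≤s⁻¹ 1+i<1+n))
... | no  _   | yes _ = alternate≢2 (toℕ i)
... | no  _   | no  _ = λ eq → alternate-suc (toℕ i) (trans eq (cong alternate j≡1+i))
cycleColor-proper n 1≤n i j (inj₂ (i≡n , j≡0)) with toℕ i ≟ n | toℕ j ≟ n
... | no  i≢n | _       = contradiction i≡n i≢n
... | yes _   | yes j≡n = contradiction (≤-trans 1≤n (≤-reflexive (trans (sym j≡n) j≡0))) λ ()
... | yes _   | no  _   rewrite j≡0 = λ ()

coloring : ∀ l m k → 1 ≤ l → Colorable (G l m k) (3 + k)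
coloring l m k 1≤l = color , fromOriented oriented
  where
  color : GVertex l k → Fin (3 + k)
  color (inj₁ i)        = cycleColor (l + l) i ↑ˡ k
  color (inj₂ (inj₁ a)) = 3 ↑ʳ a
  color (inj₂ (inj₂ a)) = 3 ↑ʳ a

  small≢large : ∀ (i : Fin 3) a → i ↑ˡ k ≢ 3 ↑ʳ a
  small≢large zero                _ ()
  small≢large (suc zero)          _ ()
  small≢large (suc (suc zero))    _ ()

  large-injective : ∀ {a b : Fin k} → toℕ b < toℕ a → 3 ↑ʳ a ≢ 3 ↑ʳ b
  large-injective b<a eq = <-irrefl (cong toℕ (sym (↑ʳ-injective 3 _ _ eq))) b<a

  oriented : ∀ x y → GRel l m k x y → color x ≢ color y
  oriented (inj₁ i)        (inj₁ j)        e   =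
    cycleColor-proper (l + l) (+-mono-≤ 1≤l z≤n) i j e ∘ ↑ˡ-injective k _ _
  oriented (inj₂ (inj₁ a)) (inj₁ i)        _   = small≢large _ a ∘ sym
  oriented (inj₂ (inj₂ a)) (inj₁ i)        _   = small≢large _ a ∘ sym
  oriented (inj₂ (inj₁ a)) (inj₂ (inj₁ b)) b<a = large-injective b<a
  oriented (inj₂ (inj₂ a)) (inj₂ (inj₂ b)) b<a = large-injective b<a
  oriented (inj₁ _)        (inj₂ _)        ()
  oriented (inj₂ (inj₁ _)) (inj₂ (inj₂ _)) ()
  oriented (inj₂ (inj₂ _)) (inj₂ (inj₁ _)) ()

chromaticNumber : ∀ l m k → 1 ≤ l → 1 ≤ m → HasChromaticNumber (G l m k) (3 + k)
chromaticNumber l m k 1≤l 1≤m = coloring l m k 1≤l , λ j j<3+k (c , proper) →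
  G-not-colorable l k 1≤l (Colorable-weaken (s≤s⁻¹ j<3+k) (c , λ u v → proper u v ∘ Adj-mono u v 1≤m))

notCritical : ∀ l m k → 2 ≤ l → 2 ≤ m → ¬ Critical (G l m (suc k)) (4 + k)
notCritical l m k 2≤l 2≤m (_ , smaller) =
  let j , j<4+k , c , proper = smaller sparser missing-u₀v₃
  in G-not-colorable l (suc k) (≤-trans (s≤s z≤n) 2≤l)
       (Colorable-weaken (s≤s⁻¹ j<4+k) ((λ v → c (v , tt)) , λ u v adj → proper (u , tt) (v , tt) adj))
  where
  1≤m : 1 ≤ m
  1≤m = ≤-trans (s≤s z≤n) 2≤m

  sparser : Subgraph (G l m (suc k))
  sparser = record
    { P     = λ _ → ⊤
    ; F     = Adj (G l 1 (suc k))
    ; F⊆Adj = λ u v → Adj-mono u v 1≤m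
    ; F-sym = λ _ _ → Data.Sum.swap
    ; F⊆P   = λ _ _ _ → tt , tt
    }

  3<1+n : 3 < suc (l + l)
  3<1+n = s≤s (+-mono-≤ 2≤l (≤-trans (s≤s z≤n) 2≤l))

  missing-u₀v₃ : ProperSubgraph sparser
  missing-u₀v₃ = inj₂ (inj₂ (inj₁ zero) , inj₁ (fromℕ< 3<1+n) ,
    inj₁ (subst (_< 2 + m) (sym (toℕ-fromℕ< 3<1+n)) (s≤s (s≤s 2≤m))) ,
    [ (λ 3<3 → <-irrefl (toℕ-fromℕ< 3<1+n) 3<3) , (λ ()) ])

2+m≤l+l : ∀ {l m} → 2 ≤ l → m ≤ 2 * l ∸ 2 → 2 + m ≤ l + l
2+m≤l+l {l} {m} 2≤l m≤2l∸2 = begin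
  2 + m           ≤⟨ +-monoʳ-≤ 2 m≤2l∸2 ⟩
  2 + (2 * l ∸ 2) ≡⟨ m+[n∸m]≡n (≤-trans 2≤l (m≤m+n l (l + 0))) ⟩
  2 * l           ≡⟨ cong (l +_) (+-identityʳ l) ⟩
  l + l           ∎
  where open ≤-Reasoning

proposition2p4 : (l m k : ℕ) → 2 ≤ l → 1 ≤ m → m ≤ 3 → m ≤ 2 * l ∸ 2 → 1 ≤ k →
    StrongChromaticChoosable (G l m k) (3 + k) ×
    (2 ≤ m → ¬ StrongCritical (G l m k) (3 + k))
proposition2p4 l m (suc k) 2≤l 1≤m m≤3 m≤2l∸2 _ =
  ( chromaticNumber l m (suc k) (≤-trans (s≤s z≤n) 2≤l) 1≤m
  , G-nonColorableAssignmentsConstant (2+m≤l+l 2≤l m≤2l∸2) (+-mono-≤ 2≤l 2≤l) m≤3 (suc k) )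
  , λ 2≤m → notCritical l m k 2≤l 2≤m ∘ proj₁
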